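{- Let $n\geq 1$ and let $\sigma=\sigma(1)\cdots\sigma(n)\in S_n(123)$. Let $\mathscr{D}=\kappa(\sigma)$ be the Dyck path of semilength $n$ associated with $\sigma$ by the map $\kappa$ described below. Then $$\mathrm{des}(\sigma)=v(\mathscr{D})+tf(\mathscr{D}),$$ where $\mathrm{des}(\sigma)$ is the number of indices $i$ with $\sigma(i)>\sigma(i+1)$, $v(\mathscr{D})$ is the number of valleys of $\mathscr{D}$, and $tf(\mathscr{D})$ is the number of triple falls of $\mathscr{D}$.
   Context: $S_n(123)$ denotes the set of permutations of $\{1,\dots,n\}$ (in one-line notation) containing no subsequence $\sigma(i)<\sigma(j)<\sigma(k)$ with $i<j<k$. A Dyck path of semilength $n$ is a word in the steps $U=(1,1)$ and $D=(1,-1)$ with $n$ of each, starting at the origin, never going below the $x$-axis, and ending on the $x$-axis. A valley of a Dyck path is an occurrence of two consecutive steps $DU$; a triple fall is an occurrence of three consecutive steps $DDD$ (occurrences may overlap). An entry $\sigma(i)$ is a left-to-right minimum if $\sigma(i)<\sigma(j)$ for all $j<i$ (so $\sigma(1)$ is one). If $x_1,\dots,x_s$ are the left-to-right minima of $\sigma$ in order, write $\sigma=x_1w_1x_2w_2\cdots x_sw_s$ with $w_i$ (possibly empty) words; for $\sigma\in S_n(123)$ the word $w_1w_2\cdots w_s$ is decreasing. The map $\kappa$: reading this decomposition from left to right, each $x_i$ is translated into $x_{i-1}-x_i$ up steps (with the convention $x_0=n+1$) and each $w_i$ is translated into $l_i+1$ down steps, where $l_i$ is the number of entries of $w_i$;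 $\kappa(\sigma)$ is the concatenation of these steps. (E.g. $\sigma=5\,7\,2\,6\,4\,3\,1$ gives $U^3D^2U^3D^4UD$.) -}

module Defs where

open import Data.Nat using (ℕ; zero; suc; _+_; _∸_; _<_; _<?_)
open import Data.Fin using (Fin)
import Data.Fin as F
open import Data.List using (List; []; _∷_; _++_; length; lookup; map; upTo; replicate)
open import Data.List.Relation.Binary.Permutation.Propositional using (_↭_)
open import Data.Product using (_×_)
open import Relation.Nullary using (¬_; yes; no; Dec)

IsPerm : ℕ → List ℕ → Set
IsPerm n σ = σ ↭ map suc (upTo n)

Avoids123 : List ℕ → Set
Avoids123 σ = (i j k : Fin (length σ)) → i F.< j → j F.< k →
  ¬ (lookup σ i < lookup σ j × lookup σ j < lookup σ k)

data Step : Set where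
  U D : Step

-- Reading σ = x₁w₁x₂w₂⋯xₛwₛ left to right with current
-- left-to-right minimum m (initially x₀ = n+1): a new left-to-right minimum x
-- contributes U^(m - x) followed by the "+1" down step of its block wᵢ;
-- every entry of a word wᵢ contributes one further down step.
-- So block i gives U^(x_{i-1}-x_i) D^(l_i+1), as in the definition.
κ-go : ℕ → List ℕ → List Step
κ-go m [] = []
κ-go m (x ∷ xs) with x <? m
... | yes _ = replicate (m ∸ x) U ++ (D ∷ κ-go x xs)
... | no  _ = D ∷ κ-go m xs

κ : ℕ → List ℕ → List Step
κ n σ = κ-go (suc n) σ

des : List ℕ → ℕ
des [] = 0
des (x ∷ []) = 0
des (x ∷ y ∷ xs) = ind (y <? x) + des (y ∷ xs)
  where
  ind : {P : Set} → Dec P → ℕ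
  ind (yes _) = 1
  ind (no _) = 0

valleys : List Step → ℕ
valleys [] = 0
valleys (D ∷ U ∷ xs) = suc (valleys (U ∷ xs))
valleys (_ ∷ xs) = valleys xs

tripleFalls : List Step → ℕ
tripleFalls [] = 0
tripleFalls (D ∷ D ∷ D ∷ xs) = suc (tripleFalls (D ∷ D ∷ xs))
tripleFalls (_ ∷ xs) = tripleFalls xs

-- Split σ ∈ S_n(123) into its left-to-right minima and the remaining entries,
-- which form a decreasing word. A descent σ(i) > σ(i+1) occurs exactly when
-- σ(i+1) is a left-to-right minimum (i ≥ 1) or when σ(i), σ(i+1) are both
-- non-minima; a minimum followed by a non-minimum is an ascent. Under κ every
-- left-to-right minimum after the first starts a new block U⁺D⁺, creating one
-- valley, and a block of l ≥ 1 non-minima gives D^(l+1), i.e. l - 1 triple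
-- falls, one per adjacent pair of non-minima.
module Submission where

open import Defs
open import Data.Nat using (ℕ; zero; suc; _≤_; _<_; _≮_; _+_; _∸_; _<?_; s≤s; z≤n)
open import Data.Nat.Properties using (<-trans; ≤∧≢⇒<; ≮⇒≥; +-suc; m<n⇒0<n∸m; suc-injective)
open import Data.List using (List; []; _∷_; _++_; replicate; length; lookup)
open import Data.Fin using (Fin)
import Data.Fin as F
open import Data.Product using (_×_; _,_)
open import Data.Empty using (⊥-elim)
open import Relation.Nullary using (¬_; yes; no)
open import Relation.Binary.PropositionalEquality using (_≡_; _≢_; refl; cong; sym; trans)
open import Relation.Binary.PropositionalEquality.Properties using (setoid)
open import Data.List.Relation.Unary.All using (All; _∷_)
open import Data.List.Relation.Unary.AllPairs using (_∷_)
open import Data.List.Relation.Unary.Unique.Propositional using (Unique)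
open import Data.List.Relation.Unary.Unique.Propositional.Properties using (map⁺; upTo⁺)
open import Data.List.Relation.Unary.Any using (here)
open import Data.List.Membership.Propositional using (_∈_)
open import Data.List.Membership.Propositional.Properties using (∈-map⁻; ∈-upTo⁻)
open import Data.List.Relation.Binary.Permutation.Propositional using (↭-sym; ↭⇒↭ₛ)
open import Data.List.Relation.Binary.Permutation.Propositional.Properties using (∈-resp-↭)
import Data.List.Relation.Binary.Permutation.Setoid.Properties as ↭ₛ

IsPerm⇒Unique : ∀ {n σ} → IsPerm n σ → Unique σ
IsPerm⇒Unique {n} σ↭ =
  ↭ₛ.Unique-resp-↭ (setoid ℕ) (↭⇒↭ₛ (↭-sym σ↭)) (map⁺ suc-injective (upTo⁺ n))

IsPerm⇒∈⇒<1+n : ∀ {n σ x} → IsPerm n σ → x ∈ σ → x < suc n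
IsPerm⇒∈⇒<1+n σ↭ x∈σ with ∈-map⁻ suc (∈-resp-↭ σ↭ x∈σ)
... | i , i∈upTo , refl = s≤s (∈-upTo⁻ i∈upTo)

≮∧≢⇒> : ∀ {m y} → y ≮ m → m ≢ y → m < y
≮∧≢⇒> y≮m m≢y = ≤∧≢⇒< (≮⇒≥ y≮m) m≢y

No12Above : ℕ → List ℕ → Set
No12Above m l = (j k : Fin (length l)) → j F.< k →
  ¬ (m < lookup l j × lookup l j < lookup l k)

No12Above-tail : ∀ {m x l} → No12Above m (x ∷ l) → No12Above m l
No12Above-tail no12 j k j<k = no12 (F.suc j) (F.suc k) (s≤s j<k)

Avoids123-tail : ∀ {x l} → Avoids123 (x ∷ l) → Avoids123 l
Avoids123-tail av i j k i<j j<k = av (F.suc i) (F.suc j) (F.suc k) (s≤s i<j) (s≤s j<k)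

Avoids123-head : ∀ {x l} → Avoids123 (x ∷ l) → No12Above x l
Avoids123-head av j k j<k = av F.zero (F.suc j) (F.suc k) (s≤s z≤n) (s≤s j<k)

valleys-Uᵏ++ : ∀ k t → valleys (replicate k U ++ t) ≡ valleys t
valleys-Uᵏ++ zero    t = refl
valleys-Uᵏ++ (suc k) t = valleys-Uᵏ++ k t

tripleFalls-Uᵏ++ : ∀ k t → tripleFalls (replicate k U ++ t) ≡ tripleFalls t
tripleFalls-Uᵏ++ zero    t = refl
tripleFalls-Uᵏ++ (suc k) t = tripleFalls-Uᵏ++ k t

valleys-D∷U⁺++ : ∀ {k} → 0 < k → ∀ t → valleys (D ∷ replicate k U ++ t) ≡ suc (valleys t)
valleys-D∷U⁺++ {suc k} _ t = cong suc (valleys-Uᵏ++ k t)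

tripleFalls-D∷U⁺++ : ∀ {k} → 0 < k → ∀ t → tripleFalls (D ∷ replicate k U ++ t) ≡ tripleFalls t
tripleFalls-D∷U⁺++ {suc k} _ t = tripleFalls-Uᵏ++ k t

tripleFalls-DD∷U⁺++ : ∀ {k} → 0 < k → ∀ t → tripleFalls (D ∷ D ∷ replicate k U ++ t) ≡ tripleFalls t
tripleFalls-DD∷U⁺++ {suc k} _ t = tripleFalls-Uᵏ++ k t

-- The head of the list has just produced the D written in front of κ-go m l;
-- after a non-minimum that D was itself preceded by a D, hence the D ∷ D.
mutual
  des-from-minimum : ∀ m l → Unique (m ∷ l) → Avoids123 (m ∷ l) →
    des (m ∷ l) ≡ valleys (D ∷ κ-go m l) + tripleFalls (D ∷ κ-go m l)
  des-from-minimum m [] _ _ = refl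
  des-from-minimum m (x ∷ l) (_ ∷ uniq) av with x <? m
  ... | yes x<m
    rewrite valleys-D∷U⁺++ (m<n⇒0<n∸m x<m) (D ∷ κ-go x l)
          | tripleFalls-D∷U⁺++ (m<n⇒0<n∸m x<m) (D ∷ κ-go x l)
    = cong suc (des-from-minimum x l uniq (Avoids123-tail av))
  des-from-minimum m (x ∷ l) ((m≢x ∷ m∉l) ∷ uniq) av | no x≮m =
    des-from-non-minimum m x l (≮∧≢⇒> x≮m m≢x) m∉l uniq
      (Avoids123-head av) (Avoids123-tail av)

  des-from-non-minimum : ∀ m x l → m < x → All (m ≢_) l → Unique (x ∷ l) →
    No12Above m (x ∷ l) → Avoids123 (x ∷ l) →
    des (x ∷ l) ≡ valleys (D ∷ κ-go m l) + tripleFalls (D ∷ D ∷ κ-go m l)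
  des-from-non-minimum m x [] _ _ _ _ _ = refl
  des-from-non-minimum m x (y ∷ l) m<x (m≢y ∷ m∉l) ((x≢y ∷ _) ∷ uniq) no12 av
    with y <? m | y <? x
  ... | yes y<m | no y≮x = ⊥-elim (y≮x (<-trans y<m m<x))
  ... | yes y<m | yes _
    rewrite valleys-D∷U⁺++ (m<n⇒0<n∸m y<m) (D ∷ κ-go y l)
          | tripleFalls-DD∷U⁺++ (m<n⇒0<n∸m y<m) (D ∷ κ-go y l)
    = cong suc (des-from-minimum y l uniq (Avoids123-tail av))
  ... | no y≮m | yes _ =
    trans (cong suc (des-from-non-minimum m y l (≮∧≢⇒> y≮m m≢y) m∉l uniq
                       (No12Above-tail no12) (Avoids123-tail av)))
          (sym (+-suc _ _))
  ... | no _   | no y≮x =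
    ⊥-elim (no12 F.zero (F.suc F.zero) (s≤s z≤n) (m<x , ≮∧≢⇒> y≮x x≢y))

proposition1 : (n : ℕ) → 1 ≤ n → (σ : List ℕ) → IsPerm n σ → Avoids123 σ →
    des σ ≡ valleys (κ n σ) + tripleFalls (κ n σ)
proposition1 n _ [] _ _ = refl
proposition1 n _ (x ∷ σ) σ↭ av with x <? suc n
... | yes _
  rewrite valleys-Uᵏ++ (suc n ∸ x) (D ∷ κ-go x σ)
        | tripleFalls-Uᵏ++ (suc n ∸ x) (D ∷ κ-go x σ)
  = des-from-minimum x σ (IsPerm⇒Unique σ↭) av
... | no x≮1+n = ⊥-elim (x≮1+n (IsPerm⇒∈⇒<1+n σ↭ (here refl)))
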